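{- Let $p,l$ be primes and $k\ge1$ an integer. Then the function $t\mapsto v_{l,k}(t^2-4p)$ on $\mathbb{Z}$ is periodic with period dividing $l^{2k}$. Moreover, there is an absolute constant $K$ such that $|\log(v_{l,k}(\Delta))-\log(v_l(\Delta))|\le K\,l^{ -k}$ for every $\Delta=t^2-4p$, $t\in\mathbb{Z}$.
   Context: For a nonzero integer $\Delta$ and a prime $l$, let $\delta$ be the largest non-negative integer with $l^{2\delta}\mid\Delta$, where for $l=2$ one additionally requires $\Delta/2^{2\delta}\equiv 0,1\pmod 4$. Define $v_l(\Delta)=(1-l^{ -2})^{ -1}(1+l^{ -1}+c)$ where $c=0$, $c=-(l+1)l^{ -\delta-2}$, or $c=-2l^{ -\delta-1}$ according as the Kronecker symbol $\left(\frac{\Delta/l^{2\delta}}{l}\right)$ equals $+1$, $0$, or $-1$. For an integer $k\ge1$, $v_{l,k}(\Delta)=v_l(\Delta)$ if $\Delta\not\equiv0\pmod{l^{2k}}$ and $v_{l,k}(\Delta)=(1-l^{ -2})^{ -1}(1+l^{ -1})$ if $\Delta\equiv0\pmod{l^{2k}}$. -}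

module Defs where

open import Data.Nat as ℕ using (ℕ; zero; suc; _∸_; _^_)
open import Data.Nat.Divisibility using (_∣?_)
open import Data.Integer as ℤ using (ℤ; +_; ∣_∣)
open import Data.Integer.DivMod using (_/ℕ_; _%ℕ_)
open import Data.Rational as ℚ using (ℚ; 0ℚ; 1ℚ)
open import Data.Bool using (Bool; true; false; if_then_else_; _∧_; _∨_)
open import Data.List using (List; upTo)
open import Data.Bool.ListAction using (any)
open import Relation.Nullary.Decidable using (⌊_⌋)

-- safe division / remainder of an integer by a natural number
-- (the divisor is always ≥ 2 where used; the zero case is a dummy)
divZ : ℤ → ℕ → ℤ
divZ x zero    = ℤ.0ℤ
divZ x (suc d) = x /ℕ suc d

modZ : ℤ → ℕ → ℕ
modZ x zero    = 0
modZ x (suc d) = x %ℕ suc d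

divides? : ℕ → ℤ → Bool
divides? m x = ⌊ m ∣? ∣ x ∣ ⌋

-- 1 / n as a rational number (for n ≥ 1; dummy value 0 for n = 0)
invℕ : ℕ → ℚ
invℕ zero    = 0ℚ
invℕ (suc n) = + 1 ℚ./ suc n

stepOK : ℕ → ℤ → Bool
stepOK l D =
  divides? (l ^ 2) D ∧
  (if ⌊ l ℕ.≟ 2 ⌋
   then (⌊ modZ (divZ D 4) 4 ℕ.≟ 0 ⌋ ∨ ⌊ modZ (divZ D 4) 4 ℕ.≟ 1 ⌋)
   else true)

-- The set of admissible δ is downward
-- closed, so the greedy value is the largest admissible δ; fuel ∣Δ∣
-- suffices for Δ ≠ 0 since each step divides ∣Δ∣ by at least 4.
deltaFuel : ℕ → ℕ → ℤ → ℕ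
deltaFuel zero    l D = 0
deltaFuel (suc f) l D =
  if stepOK l D then suc (deltaFuel f l (divZ D (l ^ 2))) else 0

delta : ℕ → ℤ → ℕ
delta l Δ = deltaFuel ∣ Δ ∣ l Δ

data Sign : Set where
  plus zer minus : Sign

kronecker : ℤ → ℕ → Sign
kronecker D l =
  if ⌊ l ℕ.≟ 2 ⌋
  then (if ⌊ modZ D 2 ℕ.≟ 0 ⌋ then zer
        else if (⌊ modZ D 8 ℕ.≟ 1 ⌋ ∨ ⌊ modZ D 8 ℕ.≟ 7 ⌋) then plus
        else minus)
  else (if divides? l D then zer
        else if any (λ x → divides? l (ℤ._-_ (+ (x ℕ.* x)) D)) (upTo l)
             then plus else minus)

-- (1 - l^{-2})^{-1} = l² / (l² - 1)
factor : ℕ → ℚ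
factor l = (+ (l ^ 2) ℚ./ 1) ℚ.* invℕ (l ^ 2 ∸ 1)

cterm : ℕ → ℤ → ℚ
cterm l Δ with kronecker (divZ Δ (l ^ (2 ℕ.* delta l Δ))) l
... | plus  = 0ℚ
... | zer   = ℚ.- ((+ (l ℕ.+ 1) ℚ./ 1) ℚ.* invℕ (l ^ (delta l Δ ℕ.+ 2)))
... | minus = ℚ.- ((+ 2 ℚ./ 1) ℚ.* invℕ (l ^ (delta l Δ ℕ.+ 1)))

v : ℕ → ℤ → ℚ
v l Δ = factor l ℚ.* ((1ℚ ℚ.+ invℕ l) ℚ.+ cterm l Δ)

vk : ℕ → ℕ → ℤ → ℚ
vk l k Δ =
  if divides? (l ^ (2 ℕ.* k)) Δ
  then factor l ℚ.* (1ℚ ℚ.+ invℕ l)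
  else v l Δ

disc : ℤ → ℕ → ℤ
disc t p = ℤ._-_ (ℤ._*_ t t) (+ (4 ℕ.* p))

{-# OPTIONS --safe #-}
module Submission where

-- Put Δ = t² − 4p and Δ′ = (t + l^{2k})² − 4p = Δ + (2t + l^{2k}) l^{2k}.  Then Δ′ ≡ Δ modulo
-- l^{2k}, and modulo 2^{2k+1} when l = 2.  If l^{2k} ∣ Δ, then l^{2k} ∣ Δ′ too and v_{l,k} is
-- the same constant at both.  Otherwise the computation of δ strips factors l² from Δ and Δ′ in
-- lockstep: each stripped factor lowers the precision of the congruence by one level, and the
-- computation stops before the congruence is used up.  At the end the two reduced discriminants
-- are still congruent modulo l (modulo 8 when l = 2), which fixes their Kronecker symbols, so
-- v_l(Δ) = v_l(Δ′).
--
-- For the estimate write v_l = F (1 + y + c) with F = (1 − l⁻²)⁻¹, y = 1/l and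
-- −2 l^{−δ−1} ≤ c ≤ 0.  Always 1 + y + c ≥ 1 − y ≥ 1/2, so v_l > 0.  If l^{2k} ∣ Δ then
-- δ ≥ k − 1, so |c| ≤ 2x with x = l^{−k}, and v_{l,k}/v_l = (1 + y)/(1 + y + c) lies in
-- [1, 1 + 4x].  Hence K = 4.

module Division where

  open import Defs using (divZ; modZ; divides?)
  open import Data.Nat as ℕ using (suc; NonZero)
  import Data.Nat.Properties as ℕ
  import Data.Nat.Divisibility as ℕ
  open import Data.Integer using (+_; ∣_∣; _+_; _*_; _-_; _⊖_)
  open import Data.Integer.Properties
    using (+-injective; +-identityˡ; +-inverseʳ; *-identityʳ; *-zeroˡ; abs-*; pos-*; ∣m⊝n∣≤m⊔n; m-n≡m⊖n;
           ∣i∣≡0⇒i≡0; i-j≡0⇒i≡j)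
  open import Data.Integer.DivMod using (_/ℕ_; _%ℕ_; a≡a%ℕn+[a/ℕn]*n; n%ℕd<d)
  open import Data.Integer.Divisibility.Signed using (_∣_; divides; _∣?_; ∣m∣n⇒∣m+n; ∣m+n∣n⇒∣m)
  open import Data.Integer.Tactic.RingSolver using (solve-∀)
  open import Data.Bool using (true; false)
  open import Data.Product using (_×_; _,_; proj₁; proj₂)
  open import Function.Bundles using (mk⇔)
  open import Relation.Binary.PropositionalEquality
  open import Relation.Nullary using (¬_)
  open import Relation.Nullary.Decidable using (yes; no; does; does-⇔; dec-true; dec-false; isYes≗does)

  division-unique : ∀ {d r r′} q q′ → r ℕ.< d → r′ ℕ.< d →
                    + r + q * + d ≡ + r′ + q′ * + d → r ≡ r′ × q ≡ q′
  division-unique {d} {r} {r′} q q′ r<d r′<d eq = r≡r′ , q≡q′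
    where
    difference : ∀ x y u w z → x + y * z ≡ u + w * z → (y - w) * z ≡ u - x
    difference x y u w z e = begin
      (y - w) * z                 ≡⟨ expand x y w z ⟩
      (x + y * z) - (x + w * z)   ≡⟨ cong (_- (x + w * z)) e ⟩
      (u + w * z) - (x + w * z)   ≡⟨ collapse u w x z ⟩
      u - x                       ∎
      where
      open ≡-Reasoning
      expand : ∀ x y w z → (y - w) * z ≡ (x + y * z) - (x + w * z)
      expand = solve-∀
      collapse : ∀ u w x z → (u + w * z) - (x + w * z) ≡ u - x
      collapse = solve-∀
    gap : (q - q′) * + d ≡ + r′ - + r
    gap = difference (+ r) q (+ r′) q′ (+ d) eq
    ∣q-q′∣<1 : ∣ q - q′ ∣ ℕ.< 1
    ∣q-q′∣<1 = ℕ.*-cancelʳ-< _ _ _ (begin-strict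
      ∣ q - q′ ∣ ℕ.* d   ≡⟨ abs-* (q - q′) (+ d) ⟨
      ∣ (q - q′) * + d ∣ ≡⟨ cong ∣_∣ (trans gap (m-n≡m⊖n r′ r)) ⟩
      ∣ r′ ⊖ r ∣         ≤⟨ ∣m⊝n∣≤m⊔n r′ r ⟩
      r′ ℕ.⊔ r           <⟨ ℕ.⊔-lub r′<d r<d ⟩
      d                  ≡⟨ ℕ.*-identityˡ d ⟨
      1 ℕ.* d            ∎)
      where open ℕ.≤-Reasoning
    q≡q′ : q ≡ q′
    q≡q′ = i-j≡0⇒i≡j q q′ (∣i∣≡0⇒i≡0 (ℕ.n<1⇒n≡0 ∣q-q′∣<1))
    r≡r′ : r ≡ r′
    r≡r′ = +-injective (sym (i-j≡0⇒i≡j (+ r′) (+ r) (begin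
      + r′ - + r         ≡⟨ gap ⟨
      (q - q′) * + d     ≡⟨ cong (λ w → (w - q′) * + d) q≡q′ ⟩
      (q′ - q′) * + d    ≡⟨ cong (_* + d) (+-inverseʳ q′) ⟩
      + 0 * + d          ≡⟨ *-zeroˡ (+ d) ⟩
      + 0                ∎)))
      where open ≡-Reasoning

  divZ-modZ-unique : ∀ {d} .{{_ : NonZero d}} {a} q {r} → r ℕ.< d → a ≡ + r + q * + d →
                     modZ a d ≡ r × divZ a d ≡ q
  divZ-modZ-unique {suc d} {a} q r<d eq =
    division-unique (a /ℕ suc d) q (n%ℕd<d a (suc d)) r<d (trans (sym (a≡a%ℕn+[a/ℕn]*n a (suc d))) eq)

  divZ-*-cancel : ∀ {d} .{{_ : NonZero d}} q → divZ (q * + d) d ≡ q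
  divZ-*-cancel {d} q = proj₂ (divZ-modZ-unique q (ℕ.>-nonZero⁻¹ d) (sym (+-identityˡ (q * + d))))

  divZ-identityʳ : ∀ a → divZ a 1 ≡ a
  divZ-identityʳ a = trans (cong (λ x → divZ x 1) (sym (*-identityʳ a))) (divZ-*-cancel a)

  divZ-cancel-factor : ∀ {a b} .{{_ : NonZero a}} .{{_ : NonZero b}} q →
                       divZ (q * + a) (a ℕ.* b) ≡ divZ q b
  divZ-cancel-factor {suc a} {suc b} q = proj₂ (divZ-modZ-unique {{ℕ.m*n≢0 (suc a) (suc b)}} Q r*a<a*b eq)
    where
    r = q %ℕ suc b
    Q = q /ℕ suc b
    r*a<a*b : r ℕ.* suc a ℕ.< suc a ℕ.* suc b
    r*a<a*b = ℕ.<-≤-trans (ℕ.*-monoˡ-< (suc a) (n%ℕd<d q (suc b))) (ℕ.≤-reflexive (ℕ.*-comm (suc b) (suc a)))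
    eq : q * + suc a ≡ + (r ℕ.* suc a) + Q * + (suc a ℕ.* suc b)
    eq = begin
      q * + suc a                                ≡⟨ cong (_* + suc a) (a≡a%ℕn+[a/ℕn]*n q (suc b)) ⟩
      (+ r + Q * + suc b) * + suc a              ≡⟨ regroup (+ r) Q (+ suc a) (+ suc b) ⟩
      + r * + suc a + Q * (+ suc a * + suc b)    ≡⟨ cong₂ (λ x y → x + Q * y) (pos-* r (suc a))
                                                                                (pos-* (suc a) (suc b)) ⟨
      + (r ℕ.* suc a) + Q * + (suc a ℕ.* suc b)  ∎
      where
      open ≡-Reasoning
      regroup : ∀ r Q a b → (r + Q * b) * a ≡ r * a + Q * (a * b)
      regroup = solve-∀

  modZ-+-∣ : ∀ {d} .{{_ : NonZero d}} a {b} → + d ∣ b → modZ (a + b) d ≡ modZ a d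
  modZ-+-∣ {suc d} a (divides k refl) = proj₁ (divZ-modZ-unique (a /ℕ suc d + k) (n%ℕd<d a (suc d)) (begin
    a + k * + suc d                                        ≡⟨ cong (_+ k * + suc d) (a≡a%ℕn+[a/ℕn]*n a (suc d)) ⟩
    (+ (a %ℕ suc d) + a /ℕ suc d * + suc d) + k * + suc d  ≡⟨ regroup (+ (a %ℕ suc d)) (a /ℕ suc d) k (+ suc d) ⟩
    + (a %ℕ suc d) + (a /ℕ suc d + k) * + suc d            ∎))
    where
    open ≡-Reasoning
    regroup : ∀ r q k d → (r + q * d) + k * d ≡ r + (q + k) * d
    regroup = solve-∀

  ∣⇒modZ≡0 : ∀ {d} .{{_ : NonZero d}} {x} → + d ∣ x → modZ x d ≡ 0
  ∣⇒modZ≡0 {suc d} {x} d∣x = trans (cong (λ y → modZ y (suc d)) (sym (+-identityˡ x))) (modZ-+-∣ (+ 0) d∣x)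

  divides?≡does : ∀ m x → divides? m x ≡ does (+ m ∣? x)
  divides?≡does m x = isYes≗does (m ℕ.∣? ∣ x ∣)

  divides?-+-∣ : ∀ {m} a {b} → + m ∣ b → divides? m (a + b) ≡ divides? m a
  divides?-+-∣ {m} a {b} m∣b = begin
    divides? m (a + b)      ≡⟨ divides?≡does m (a + b) ⟩
    does (+ m ∣? (a + b))   ≡⟨ does-⇔ (mk⇔ (λ m∣a+b → ∣m+n∣n⇒∣m m∣a+b m∣b) (λ m∣a → ∣m∣n⇒∣m+n m∣a m∣b))
                                     (+ m ∣? (a + b)) (+ m ∣? a) ⟩
    does (+ m ∣? a)         ≡⟨ divides?≡does m a ⟨
    divides? m a            ∎
    where open ≡-Reasoning

  ∣⇒divides?≡true : ∀ {m x} → + m ∣ x → divides? m x ≡ true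
  ∣⇒divides?≡true {m} {x} m∣x = trans (divides?≡does m x) (dec-true (+ m ∣? x) m∣x)

  ∤⇒divides?≡false : ∀ {m x} → ¬ (+ m ∣ x) → divides? m x ≡ false
  ∤⇒divides?≡false {m} {x} m∤x = trans (divides?≡does m x) (dec-false (+ m ∣? x) m∤x)

  divides?≡false⇒∤ : ∀ {m x} → divides? m x ≡ false → ¬ (+ m ∣ x)
  divides?≡false⇒∤ e m∣x with () ← trans (sym (∣⇒divides?≡true m∣x)) e

  divides?≡true⇒∣ : ∀ {m x} → divides? m x ≡ true → + m ∣ x
  divides?≡true⇒∣ {m} {x} e with + m ∣? x in d
  ... | yes m∣x = m∣x
  ... | no _ with () ← trans (sym e) (trans (divides?≡does m x) (cong does d))

module LocalData where

  open import Defs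
  open Division
  open import Data.Nat as ℕ using (ℕ; zero; suc; NonZero; _^_)
  import Data.Nat.Properties as ℕ
  import Data.Nat.Divisibility as ℕ
  open import Data.Integer as ℤ using (ℤ; +_; _+_; _*_; _-_; -_)
  open import Data.Integer.Properties using (pos-*; *-identityʳ; *-assoc; *-distribʳ-+; ∣i∣≡0⇒i≡0)
  open import Data.Integer.Divisibility.Signed
    using (_∣_; divides; ∣ᵤ⇒∣; ∣⇒∣ᵤ; ∣-refl; ∣-trans; ∣n⇒∣m*n; ∣m⇒∣m*n; ∣m⇒∣-m)
  open import Data.Integer.Tactic.RingSolver using (solve-∀)
  open import Data.Bool using (true; false; if_then_else_; _∨_)
  import Data.Bool.Properties as Bool
  open import Data.Bool.ListAction using (or)
  open import Data.List using (upTo)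
  open import Data.List.Properties using (map-cong)
  open import Data.Product using (_×_; _,_; ∃-syntax; map₁)
  open import Data.Sum using (inj₁; inj₂)
  open import Function using (_∘_)
  open import Relation.Binary.PropositionalEquality
  open import Relation.Nullary using (¬_; yes; no; contradiction)
  open import Relation.Nullary.Decidable using (⌊_⌋)

  *-pres-∣ : ∀ {a b c d} → a ∣ b → c ∣ d → a * c ∣ b * d
  *-pres-∣ {a} {c = c} (divides q refl) (divides r refl) = divides (q * r) (regroup q a r c)
    where
    regroup : ∀ q a r c → (q * a) * (r * c) ≡ (q * r) * (a * c)
    regroup = solve-∀

  ^-2*suc : ∀ l n → l ^ (2 ℕ.* suc n) ≡ l ^ 2 ℕ.* l ^ (2 ℕ.* n)
  ^-2*suc l n = trans (cong (l ^_) (ℕ.*-suc 2 n)) (ℕ.^-distribˡ-+-* l 2 (2 ℕ.* n))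

  *-l^[2*suc] : ∀ l n q → q * + (l ^ (2 ℕ.* suc n)) ≡ (q * + (l ^ (2 ℕ.* n))) * + (l ^ 2)
  *-l^[2*suc] l n q = begin
    q * + (l ^ (2 ℕ.* suc n))              ≡⟨ cong (λ m → q * + m) (trans (^-2*suc l n) (ℕ.*-comm (l ^ 2) _)) ⟩
    q * + (l ^ (2 ℕ.* n) ℕ.* l ^ 2)        ≡⟨ cong (q *_) (pos-* (l ^ (2 ℕ.* n)) (l ^ 2)) ⟩
    q * (+ (l ^ (2 ℕ.* n)) * + (l ^ 2))    ≡⟨ *-assoc q _ _ ⟨
    (q * + (l ^ (2 ℕ.* n))) * + (l ^ 2)    ∎
    where open ≡-Reasoning

  l²∣l^[2*suc] : ∀ l n → + (l ^ 2) ∣ + (l ^ (2 ℕ.* suc n))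
  l²∣l^[2*suc] l n = ∣ᵤ⇒∣ (ℕ.divides (l ^ (2 ℕ.* n)) (trans (^-2*suc l n) (ℕ.*-comm (l ^ 2) _)))

  l∣l² : ∀ l → + l ∣ + (l ^ 2)
  l∣l² l = ∣ᵤ⇒∣ (ℕ.m∣m*n (l ^ 1))

  -- D′ ≡ D modulo l^{2n}, and modulo 2^{2n+1} when l = 2: the extra factor 2 is what the
  -- Kronecker symbol at 2 (which reads D modulo 8) needs at the last level.
  CongruentAtLevel : ℕ → ℕ → ℤ → ℤ → Set
  CongruentAtLevel l n D D′ = ∃[ g ] D′ ≡ D + g * + (l ^ (2 ℕ.* n)) × (l ≡ 2 → + 2 ∣ g)

  LocallyCongruent : ℕ → ℤ → ℤ → Set
  LocallyCongruent l D D′ = ∃[ j ] CongruentAtLevel l (suc j) D D′ × ¬ (+ (l ^ (2 ℕ.* suc j)) ∣ D)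

  congruent-descend : ∀ {l n D q D′} → D ≡ q * + (l ^ 2) → CongruentAtLevel l (suc n) D D′ →
                      ∃[ q′ ] D′ ≡ q′ * + (l ^ 2) × CongruentAtLevel l n q q′
  congruent-descend {l} {n} {q = q} refl (g , refl , parity) =
    q + g * + (l ^ (2 ℕ.* n)) , factor-l² , g , refl , parity
    where
    factor-l² : q * + (l ^ 2) + g * + (l ^ (2 ℕ.* suc n)) ≡ (q + g * + (l ^ (2 ℕ.* n))) * + (l ^ 2)
    factor-l² = trans (cong (λ x → q * + (l ^ 2) + x) (*-l^[2*suc] l n g)) (sym (*-distribʳ-+ (+ (l ^ 2)) q _))

  ∤-descend : ∀ {l n D q} → D ≡ q * + (l ^ 2) → ¬ (+ (l ^ (2 ℕ.* suc n)) ∣ D) → ¬ (+ (l ^ (2 ℕ.* n)) ∣ q)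
  ∤-descend {l} {n} refl D∤ (divides r refl) = D∤ (divides r (sym (*-l^[2*suc] l n r)))

  locallyCongruent-descend : ∀ {l D D′ q} → D ≡ q * + (l ^ 2) → LocallyCongruent l D D′ →
                             ∃[ q′ ] D′ ≡ q′ * + (l ^ 2) × LocallyCongruent l q q′
  locallyCongruent-descend {q = q} D≡ql² (zero , _ , D∤) = contradiction (divides q D≡ql²) D∤
  locallyCongruent-descend {l} {D} {q = q} D≡ql² (suc j , c , D∤)
    with congruent-descend {l} {suc j} {D} {q} D≡ql² c
  ... | q′ , D′≡q′l² , c′ = q′ , D′≡q′l² , j , c′ , ∤-descend {l} {suc j} D≡ql² D∤

  kronecker-2-cong : ∀ {D D′} → modZ D 2 ≡ modZ D′ 2 → modZ D 8 ≡ modZ D′ 8 →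
                     kronecker D 2 ≡ kronecker D′ 2
  kronecker-2-cong e₂ e₈ rewrite e₂ | e₈ = refl

  kronecker-congruent : ∀ {l j D D′} → CongruentAtLevel l (suc j) D D′ → kronecker D l ≡ kronecker D′ l
  kronecker-congruent {l} {j} {D} (g , refl , parity) with l ℕ.≟ 2
  ... | yes refl = kronecker-2-cong {D} {D + g * L}
                     (sym (modZ-+-∣ D (∣m⇒∣m*n L 2∣g))) (sym (modZ-+-∣ D (*-pres-∣ 2∣g (l²∣l^[2*suc] 2 j))))
    where
    L = + (2 ^ (2 ℕ.* suc j))
    2∣g = parity refl
  ... | no _ = cong₂ (λ b c → if b then zer else if c then plus else minus)
                     (sym (divides?-+-∣ D l∣gL)) (cong or (map-cong x²-D (upTo l)))
    where
    L = + (l ^ (2 ℕ.* suc j))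
    l∣gL : + l ∣ g * L
    l∣gL = ∣n⇒∣m*n g (∣-trans (l∣l² l) (l²∣l^[2*suc] l j))
    x²-D : ∀ x → divides? l (+ (x ℕ.* x) - D) ≡ divides? l (+ (x ℕ.* x) - (D + g * L))
    x²-D x = sym (trans (cong (divides? l) (regroup (+ (x ℕ.* x)) D (g * L)))
                        (divides?-+-∣ (+ (x ℕ.* x) - D) (∣m⇒∣-m l∣gL)))
      where
      regroup : ∀ a b c → a - (b + c) ≡ (a - b) + - c
      regroup = solve-∀

  quarter-mod-4-congruent : ∀ {j D D′} → CongruentAtLevel 2 (suc (suc j)) D D′ → + 4 ∣ D →
                            modZ (divZ D 4) 4 ≡ modZ (divZ D′ 4) 4
  quarter-mod-4-congruent {j} {D} {D′} c (divides q D≡4q) with congruent-descend {2} {suc j} {D} {q} D≡4q c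
  ... | q′ , D′≡4q′ , g , refl , _ = begin
    modZ (divZ D 4) 4             ≡⟨ cong (λ x → modZ (divZ x 4) 4) D≡4q ⟩
    modZ (divZ (q * + 4) 4) 4     ≡⟨ cong (λ x → modZ x 4) (divZ-*-cancel {4} q) ⟩
    modZ q 4                      ≡⟨ modZ-+-∣ {4} q (∣n⇒∣m*n g (l²∣l^[2*suc] 2 j)) ⟨
    modZ q′ 4                     ≡⟨ cong (λ x → modZ x 4) (divZ-*-cancel {4} q′) ⟨
    modZ (divZ (q′ * + 4) 4) 4    ≡⟨ cong (λ x → modZ (divZ x 4) 4) D′≡4q′ ⟨
    modZ (divZ D′ 4) 4            ∎
    where open ≡-Reasoning

  stepOK-congruent : ∀ {l j D D′} → CongruentAtLevel l (suc j) D D′ → ¬ (+ (l ^ (2 ℕ.* suc j)) ∣ D) →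
                     stepOK l D ≡ stepOK l D′
  stepOK-congruent {l} {zero} {D} (g , refl , _) D∤
    rewrite divides?-+-∣ D (∣n⇒∣m*n g (∣-refl {+ (l ^ 2)})) | ∤⇒divides?≡false D∤ = refl
  stepOK-congruent {l} {suc j} {D} c@(g , refl , _) D∤
    rewrite divides?-+-∣ D (∣n⇒∣m*n g (l²∣l^[2*suc] l (suc j)))
    with divides? (l ^ 2) D in l²∣?D | l ℕ.≟ 2
  ... | false | _        = refl
  ... | true  | no _     = refl
  ... | true  | yes refl =
    cong (λ r → ⌊ r ℕ.≟ 0 ⌋ ∨ ⌊ r ℕ.≟ 1 ⌋)
         (quarter-mod-4-congruent {j} {D} c (divides?≡true⇒∣ l²∣?D))

  stepOK≡true⇒l²∣ : ∀ {l D} → stepOK l D ≡ true → + (l ^ 2) ∣ D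
  stepOK≡true⇒l²∣ {l} {D} ok with divides? (l ^ 2) D in l²∣?D
  ... | true = divides?≡true⇒∣ l²∣?D

  ∣⇒stepOK≡true : ∀ {l j D} → + (l ^ (2 ℕ.* suc (suc j))) ∣ D → stepOK l D ≡ true
  ∣⇒stepOK≡true {l} {j} (divides q refl)
    rewrite *-l^[2*suc] l (suc j) q
          | ∣⇒divides?≡true (∣n⇒∣m*n (q * + (l ^ (2 ℕ.* suc j))) (∣-refl {+ (l ^ 2)}))
    with l ℕ.≟ 2
  ... | no _     = refl
  ... | yes refl = cong (λ r → ⌊ r ℕ.≟ 0 ⌋ ∨ ⌊ r ℕ.≟ 1 ⌋)
                     (trans (cong (λ x → modZ x 4) (divZ-*-cancel {4} D/4))
                            (∣⇒modZ≡0 {4} {D/4} (∣n⇒∣m*n q (l²∣l^[2*suc] 2 j))))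
    where D/4 = q * + (2 ^ (2 ℕ.* suc j))

  deltaSymbol : ℕ → ℕ → ℤ → ℕ × Sign
  deltaSymbol f l D = deltaFuel f l D , kronecker (divZ D (l ^ (2 ℕ.* deltaFuel f l D))) l

  deltaSymbol-fuel : ∀ {f f′ l D} → deltaFuel f l D ≡ deltaFuel f′ l D → deltaSymbol f l D ≡ deltaSymbol f′ l D
  deltaSymbol-fuel {l = l} {D} = cong (λ d → d , kronecker (divZ D (l ^ (2 ℕ.* d))) l)

  deltaSymbol-stop : ∀ {f l D} → stepOK l D ≡ false → deltaSymbol (suc f) l D ≡ deltaSymbol 0 l D
  deltaSymbol-stop ok rewrite ok = refl

  deltaSymbol-step : ∀ {f l D q} .{{_ : NonZero l}} → stepOK l D ≡ true → D ≡ q * + (l ^ 2) →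
                     deltaSymbol (suc f) l D ≡ map₁ suc (deltaSymbol f l q)
  deltaSymbol-step {f} {l} {D} {q} ok refl
    rewrite ok | divZ-*-cancel {l ^ 2} {{ℕ.m^n≢0 l 2}} q = cong (λ x → suc d , kronecker x l) reduce
    where
    d = deltaFuel f l q
    reduce : divZ (q * + (l ^ 2)) (l ^ (2 ℕ.* suc d)) ≡ divZ q (l ^ (2 ℕ.* d))
    reduce = trans (cong (divZ (q * + (l ^ 2))) (^-2*suc l d))
                   (divZ-cancel-factor {{ℕ.m^n≢0 l 2}} {{ℕ.m^n≢0 l (2 ℕ.* d)}} q)

  deltaSymbol-zero-congruent : ∀ {l D D′} → LocallyCongruent l D D′ → deltaSymbol 0 l D ≡ deltaSymbol 0 l D′
  deltaSymbol-zero-congruent {l} {D} {D′} (j , c , _)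
    rewrite divZ-identityʳ D | divZ-identityʳ D′ = cong (0 ,_) (kronecker-congruent {l} {j} {D} {D′} c)

  deltaSymbol-congruent : ∀ {l D D′} .{{_ : NonZero l}} f → LocallyCongruent l D D′ →
                          deltaSymbol f l D ≡ deltaSymbol f l D′
  deltaSymbol-congruent zero c = deltaSymbol-zero-congruent c
  deltaSymbol-congruent {l} {D} {D′} (suc f) c@(j , c₀ , D∤) with stepOK l D Bool.≟ true
  ... | no ¬ok = begin
    deltaSymbol (suc f) l D    ≡⟨ deltaSymbol-stop {f} {l} {D} ok ⟩
    deltaSymbol 0 l D          ≡⟨ deltaSymbol-zero-congruent c ⟩
    deltaSymbol 0 l D′         ≡⟨ deltaSymbol-stop {f} {l} {D′} ok′ ⟨
    deltaSymbol (suc f) l D′   ∎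
    where
    open ≡-Reasoning
    ok = Bool.¬-not ¬ok
    ok′ = trans (sym (stepOK-congruent {l} {j} {D} {D′} c₀ D∤)) ok
  ... | yes ok with stepOK≡true⇒l²∣ {l} {D} ok
  ...   | divides q D≡ql² with locallyCongruent-descend D≡ql² c
  ...     | q′ , D′≡q′l² , c′ = begin
    deltaSymbol (suc f) l D       ≡⟨ deltaSymbol-step {f} ok D≡ql² ⟩
    map₁ suc (deltaSymbol f l q)  ≡⟨ cong (map₁ suc) (deltaSymbol-congruent f c′) ⟩
    map₁ suc (deltaSymbol f l q′) ≡⟨ deltaSymbol-step {f} ok′ D′≡q′l² ⟨
    deltaSymbol (suc f) l D′      ∎
    where
    open ≡-Reasoning
    ok′ = trans (sym (stepOK-congruent {l} {j} {D} {D′} c₀ D∤)) ok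

  deltaFuel-saturated : ∀ {l f f′ D} .{{_ : NonZero l}} → ¬ (+ (l ^ (2 ℕ.* f)) ∣ D) → f ℕ.≤ f′ →
                        deltaFuel f′ l D ≡ deltaFuel f l D
  deltaFuel-saturated {f = zero} {D = D} D∤ _ = contradiction (divides D (sym (*-identityʳ D))) D∤
  deltaFuel-saturated {l} {suc f} {suc f′} {D} D∤ (ℕ.s≤s f≤f′) with stepOK l D in ok
  ... | false = refl
  ... | true with stepOK≡true⇒l²∣ {l} {D} ok
  ...   | divides q D≡ql² = cong suc (begin
    deltaFuel f′ l (divZ D (l ^ 2))   ≡⟨ cong (deltaFuel f′ l) quotient ⟩
    deltaFuel f′ l q                  ≡⟨ deltaFuel-saturated (∤-descend {l} {f} D≡ql² D∤) f≤f′ ⟩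
    deltaFuel f l q                   ≡⟨ cong (deltaFuel f l) quotient ⟨
    deltaFuel f l (divZ D (l ^ 2))    ∎)
    where
    open ≡-Reasoning
    quotient : divZ D (l ^ 2) ≡ q
    quotient = trans (cong (λ x → divZ x (l ^ 2)) D≡ql²) (divZ-*-cancel {{ℕ.m^n≢0 l 2}} q)

  deltaFuel-irrelevant : ∀ {l f f′ D} .{{_ : NonZero l}} → ¬ (+ (l ^ (2 ℕ.* f)) ∣ D) →
                         ¬ (+ (l ^ (2 ℕ.* f′)) ∣ D) → deltaFuel f l D ≡ deltaFuel f′ l D
  deltaFuel-irrelevant {f = f} {f′} D∤ D∤′ with ℕ.≤-total f f′
  ... | inj₁ f≤f′ = sym (deltaFuel-saturated D∤ f≤f′)
  ... | inj₂ f′≤f = deltaFuel-saturated D∤′ f′≤f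

  deltaFuel-lower : ∀ {l j f D} .{{_ : NonZero l}} → j ℕ.≤ f → + (l ^ (2 ℕ.* suc j)) ∣ D →
                    j ℕ.≤ deltaFuel f l D
  deltaFuel-lower {j = zero} _ _ = ℕ.z≤n
  deltaFuel-lower {l} {suc j} {suc f} (ℕ.s≤s j≤f) (divides q refl)
    rewrite ∣⇒stepOK≡true {l} {j} (divides q refl) | *-l^[2*suc] l (suc j) q
          | divZ-*-cancel {l ^ 2} {{ℕ.m^n≢0 l 2}} (q * + (l ^ (2 ℕ.* suc j)))
    = ℕ.s≤s (deltaFuel-lower j≤f (divides q refl))

  n<l^n : ∀ {l} → 1 ℕ.< l → ∀ n → n ℕ.< l ^ n
  n<l^n _ zero = ℕ.s≤s ℕ.z≤n
  n<l^n {l} 1<l (suc n) = ℕ.<-≤-trans (ℕ.s≤s (n<l^n 1<l n))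
    (ℕ.≤-trans (ℕ.m<m*n (l ^ n) l 1<l) (ℕ.≤-reflexive (ℕ.*-comm (l ^ n) l)))
    where instance _ = ℕ.m^n≢0 l n {{ℕ.>-nonZero (ℕ.<-trans ℕ.z<s 1<l)}}

  exponent<∣∣ : ∀ {l n D} → 1 ℕ.< l → D ≢ + 0 → + (l ^ n) ∣ D → n ℕ.< ℤ.∣ D ∣
  exponent<∣∣ {n = n} 1<l D≢0 lⁿ∣D =
    ℕ.<-≤-trans (n<l^n 1<l n) (ℕ.∣⇒≤ {{ℕ.≢-nonZero (D≢0 ∘ ∣i∣≡0⇒i≡0)}} (∣⇒∣ᵤ lⁿ∣D))

  deltaSymbol-saturated : ∀ {l f D} .{{_ : NonZero l}} → 1 ℕ.< l → D ≢ + 0 → ¬ (+ (l ^ (2 ℕ.* f)) ∣ D) →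
                          deltaSymbol ℤ.∣ D ∣ l D ≡ deltaSymbol f l D
  deltaSymbol-saturated {l} {f} {D} 1<l D≢0 D∤ =
    deltaSymbol-fuel {ℤ.∣ D ∣} {f} (deltaFuel-irrelevant {l} {ℤ.∣ D ∣} {f} D∤∣D∣ D∤)
    where
    D∤∣D∣ : ¬ (+ (l ^ (2 ℕ.* ℤ.∣ D ∣)) ∣ D)
    D∤∣D∣ l^[2∣D∣]∣D = ℕ.<⇒≱ (exponent<∣∣ 1<l D≢0 l^[2∣D∣]∣D) (ℕ.m≤n*m ℤ.∣ D ∣ 2)

  -- Only j ≤ δ, not j + 1 ≤ δ: for l = 2 the last step may fail the condition Δ/4^{j+1} ≡ 0, 1 (mod 4).
  delta-lower : ∀ {l j D} .{{_ : NonZero l}} → 1 ℕ.< l → D ≢ + 0 → + (l ^ (2 ℕ.* suc j)) ∣ D →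
                j ℕ.≤ delta l D
  delta-lower {j = j} 1<l D≢0 l^[2j+2]∣D = deltaFuel-lower j≤∣D∣ l^[2j+2]∣D
    where
    j≤∣D∣ = ℕ.<⇒≤ (ℕ.≤-<-trans (ℕ.≤-trans (ℕ.n≤1+n j) (ℕ.m≤n*m (suc j) 2))
                               (exponent<∣∣ 1<l D≢0 l^[2j+2]∣D))

module Discriminant where

  open import Defs using (disc)
  open LocalData using (CongruentAtLevel; l²∣l^[2*suc])
  open import Data.Nat as ℕ using (suc; _^_)
  import Data.Nat.Properties as ℕ
  import Data.Nat.Divisibility as ℕ
  open import Data.Nat.Primality using (Prime; prime[2]; euclidsLemma; composite; composite⇒¬prime; prime⇒nonTrivial)
  import Data.Nat.Tactic.RingSolver as ℕ-Solver
  open import Data.Integer using (+_; ∣_∣; _+_; _*_; _-_)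
  open import Data.Integer.Properties using (abs-*; i-j≡0⇒i≡j)
  open import Data.Integer.Divisibility.Signed using (_∣_; divides; ∣-trans; ∣m∣n⇒∣m+n)
  open import Data.Integer.Tactic.RingSolver using (solve-∀)
  open import Data.Product using (_,_)
  open import Data.Sum using ([_,_]′)
  open import Function using (id)
  open import Relation.Binary.PropositionalEquality
  open import Relation.Nullary using (¬_)

  prime⇒1< : ∀ {p} → Prime p → 1 ℕ.< p
  prime⇒1< {p} pp = ℕ.nonTrivial⇒n>1 p {{prime⇒nonTrivial pp}}

  ¬prime-square : ∀ m → ¬ Prime (m ℕ.* m)
  ¬prime-square 0 pp with () ← prime⇒1< pp
  ¬prime-square 1 pp with ℕ.s≤s () ← prime⇒1< pp
  ¬prime-square m@(suc (suc _)) =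
    composite⇒¬prime (composite (ℕ.m<m*n m m (ℕ.s≤s (ℕ.s≤s ℕ.z≤n))) (ℕ.m∣m*n m))

  square≢4*prime : ∀ {p} n → Prime p → n ℕ.* n ≢ 4 ℕ.* p
  square≢4*prime {p} n pp n²≡4p
    with [ id , id ]′ (euclidsLemma n n prime[2] (ℕ.divides (2 ℕ.* p) (trans n²≡4p (double p))))
    where
    double : ∀ p → 4 ℕ.* p ≡ 2 ℕ.* p ℕ.* 2
    double = ℕ-Solver.solve-∀
  ... | ℕ.divides m refl =
    ¬prime-square m (subst Prime (sym (ℕ.*-cancelˡ-≡ (m ℕ.* m) p 4 (trans (quadruple m) n²≡4p))) pp)
    where
    quadruple : ∀ m → 4 ℕ.* (m ℕ.* m) ≡ m ℕ.* 2 ℕ.* (m ℕ.* 2)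
    quadruple = ℕ-Solver.solve-∀

  disc≢0 : ∀ {p} t → Prime p → disc t p ≢ + 0
  disc≢0 {p} t pp Δ≡0 =
    square≢4*prime ∣ t ∣ pp (trans (sym (abs-* t t)) (cong ∣_∣ (i-j≡0⇒i≡j (t * t) (+ (4 ℕ.* p)) Δ≡0)))

  disc-congruent : ∀ {l} j t p → CongruentAtLevel l (suc j) (disc t p) (disc (t + + (l ^ (2 ℕ.* suc j))) p)
  disc-congruent {l} j t p = t + t + L , expand t (+ (4 ℕ.* p)) L , parity
    where
    L = + (l ^ (2 ℕ.* suc j))
    expand : ∀ t P L → (t + L) * (t + L) - P ≡ (t * t - P) + (t + t + L) * L
    expand = solve-∀
    parity : l ≡ 2 → + 2 ∣ t + t + L
    parity refl = ∣m∣n⇒∣m+n (divides t (double t)) (∣-trans (divides (+ 2) refl) (l²∣l^[2*suc] 2 j))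
      where
      double : ∀ t → t + t ≡ t * + 2
      double = solve-∀

module RationalBounds where

  open import Defs using (invℕ; factor)
  open import Data.Nat as ℕ using (zero; suc; _^_)
  import Data.Nat.Properties as ℕ
  import Data.Nat.Tactic.RingSolver as ℕ-Solver
  open import Data.Integer as ℤ using (+_)
  import Data.Integer.Properties as ℤ
  open import Data.Rational as ℚ using (ℚ; 0ℚ; 1ℚ; _+_; _*_; _-_; -_; _≤_; _/_; nonNegative)
  open import Data.Rational.Properties
    using (≤-refl; +-mono-≤; +-monoˡ-≤; +-monoʳ-≤; *-monoˡ-≤-nonNeg; +-identityʳ; +-inverseʳ;
           nonNegative⁻¹; nonNeg*nonNeg⇒nonNeg; toℚᵘ-cancel-≤; toℚᵘ-fromℚᵘ; toℚᵘ-homo-*; toℚᵘ-injective)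
  import Data.Rational.Unnormalised as ℚᵘ
  import Data.Rational.Unnormalised.Properties as ℚᵘ
  open import Data.Rational.Solver using (module +-*-Solver)
  open import Relation.Binary.PropositionalEquality

  open +-*-Solver

  two four : ℚ
  two = + 2 / 1
  four = + 4 / 1

  0≤1 : 0ℚ ≤ 1ℚ
  0≤1 = ℚ.*≤* (ℤ.+≤+ ℕ.z≤n)

  0≤two : 0ℚ ≤ two
  0≤two = ℚ.*≤* (ℤ.+≤+ ℕ.z≤n)

  0≤four : 0ℚ ≤ four
  0≤four = ℚ.*≤* (ℤ.+≤+ ℕ.z≤n)

  nonNeg-* : ∀ {p q} → 0ℚ ≤ p → 0ℚ ≤ q → 0ℚ ≤ p * q
  nonNeg-* {p} {q} 0≤p 0≤q =
    nonNegative⁻¹ (p * q) {{nonNeg*nonNeg⇒nonNeg p {{nonNegative 0≤p}} q {{nonNegative 0≤q}}}}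

  0≤q-p⇒p≤q : ∀ p q → 0ℚ ≤ q - p → p ≤ q
  0≤q-p⇒p≤q p q 0≤q-p =
    subst₂ _≤_ (+-identityʳ p) (solve 2 (λ p q → p :+ (q :- p) := q) refl p q) (+-monoʳ-≤ p 0≤q-p)

  p≤q⇒0≤q-p : ∀ p q → p ≤ q → 0ℚ ≤ q - p
  p≤q⇒0≤q-p p q p≤q = subst (_≤ q - p) (+-inverseʳ p) (+-monoˡ-≤ (- p) p≤q)

  /-mono-cross : ∀ i j m n → i ℤ.* + suc n ℤ.≤ j ℤ.* + suc m → i / suc m ≤ j / suc n
  /-mono-cross i j m n le = toℚᵘ-cancel-≤ (ℚᵘ.≤-respˡ-≃ (ℚᵘ.≃-sym (toℚᵘ-fromℚᵘ (ℚᵘ.mkℚᵘ i m)))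
                              (ℚᵘ.≤-respʳ-≃ (ℚᵘ.≃-sym (toℚᵘ-fromℚᵘ (ℚᵘ.mkℚᵘ j n))) (ℚᵘ.*≤* le)))

  fromℕ*invℕ : ∀ a n → (+ a / 1) * invℕ (suc n) ≡ + a / suc n
  fromℕ*invℕ a n = toℚᵘ-injective (ℚᵘ.≃-trans (toℚᵘ-homo-* (+ a / 1) (+ 1 / suc n))
    (ℚᵘ.≃-trans (ℚᵘ.*-cong (toℚᵘ-fromℚᵘ (ℚᵘ.mkℚᵘ (+ a) 0)) (toℚᵘ-fromℚᵘ (ℚᵘ.mkℚᵘ (+ 1) n)))
    (ℚᵘ.≃-trans (ℚᵘ.*≡* cross) (ℚᵘ.≃-sym (toℚᵘ-fromℚᵘ (ℚᵘ.mkℚᵘ (+ a) n))))))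
    where
    cross : (+ a ℤ.* + 1) ℤ.* + suc n ≡ + a ℤ.* + (1 ℕ.* suc n)
    cross = cong₂ ℤ._*_ (ℤ.*-identityʳ (+ a)) (cong +_ (sym (ℕ.*-identityˡ (suc n))))

  0≤fromℕ/ : ∀ a n → 0ℚ ≤ + a / suc n
  0≤fromℕ/ a n = /-mono-cross (+ 0) (+ a) 0 n (subst (+ 0 ℤ.≤_) (sym (ℤ.*-identityʳ (+ a))) (ℤ.+≤+ ℕ.z≤n))

  invℕ-nonNeg : ∀ n → 0ℚ ≤ invℕ n
  invℕ-nonNeg zero    = ≤-refl
  invℕ-nonNeg (suc n) = 0≤fromℕ/ 1 n

  invℕ-antimono : ∀ {m n} → 1 ℕ.≤ m → m ℕ.≤ n → invℕ n ≤ invℕ m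
  invℕ-antimono {suc m} {suc n} _ m≤n =
    /-mono-cross (+ 1) (+ 1) n m (subst₂ ℤ._≤_ (sym (ℤ.*-identityˡ _)) (sym (ℤ.*-identityˡ _)) (ℤ.+≤+ m≤n))

  invℕ-half : ∀ {l} → 1 ℕ.< l → invℕ l + invℕ l ≤ 1ℚ
  invℕ-half 1<l = +-mono-≤ (invℕ-antimono (ℕ.s≤s ℕ.z≤n) 1<l) (invℕ-antimono (ℕ.s≤s ℕ.z≤n) 1<l)

  factor-nonNeg : ∀ l → 0ℚ ≤ factor l
  factor-nonNeg l = nonNeg-* (0≤fromℕ/ (l ^ 2) 0) (invℕ-nonNeg (l ^ 2 ℕ.∸ 1))

  [1+l]invℕ[M*l]≤two*invℕM : ∀ {l M} → 1 ℕ.≤ l → 1 ℕ.≤ M →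
                             (+ (l ℕ.+ 1) / 1) * invℕ (M ℕ.* l) ≤ two * invℕ M
  [1+l]invℕ[M*l]≤two*invℕM {suc l} {suc M} _ _ =
    subst₂ _≤_ (sym (fromℕ*invℕ (suc l ℕ.+ 1) (l ℕ.+ M ℕ.* suc l))) (sym (fromℕ*invℕ 2 M))
      (/-mono-cross (+ (suc l ℕ.+ 1)) (+ 2) (l ℕ.+ M ℕ.* suc l) M
        (subst₂ ℤ._≤_ (ℤ.pos-* (suc l ℕ.+ 1) (suc M)) (ℤ.pos-* 2 (suc M ℕ.* suc l)) (ℤ.+≤+ cross)))
    where
    cross : (suc l ℕ.+ 1) ℕ.* suc M ℕ.≤ 2 ℕ.* (suc M ℕ.* suc l)
    cross = begin
      (suc l ℕ.+ 1) ℕ.* suc M        ≤⟨ ℕ.*-monoˡ-≤ (suc M) (ℕ.+-monoʳ-≤ (suc l) (ℕ.s≤s ℕ.z≤n)) ⟩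
      (suc l ℕ.+ suc l) ℕ.* suc M    ≡⟨ regroup (suc l) (suc M) ⟩
      2 ℕ.* (suc M ℕ.* suc l)        ∎
      where
      open ℕ.≤-Reasoning
      regroup : ∀ L M → (L ℕ.+ L) ℕ.* M ≡ 2 ℕ.* (M ℕ.* L)
      regroup = ℕ-Solver.solve-∀

  ≤-[1+ε]* : ∀ {ε a} → 0ℚ ≤ ε → 0ℚ ≤ a → a ≤ (1ℚ + ε) * a
  ≤-[1+ε]* {ε} {a} 0≤ε 0≤a = 0≤q-p⇒p≤q _ _
    (subst (0ℚ ≤_) (solve 2 (λ ε a → ε :* a := (con 1ℚ :+ ε) :* a :- a) refl ε a) (nonNeg-* 0≤ε 0≤a))

  *-+-nonPos-≤ : ∀ {F w c} → 0ℚ ≤ F → c ≤ 0ℚ → F * (w + c) ≤ F * w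
  *-+-nonPos-≤ {F} {w} 0≤F c≤0 =
    subst (F * (w + _) ≤_) (cong (F *_) (+-identityʳ w)) (*-monoˡ-≤-nonNeg F {{nonNegative 0≤F}} (+-monoʳ-≤ w c≤0))

  1+y+c-nonNeg : ∀ {F y c} → 0ℚ ≤ F → 0ℚ ≤ y → y + y ≤ 1ℚ → - (two * y) ≤ c →
                 0ℚ ≤ F * ((1ℚ + y) + c)
  1+y+c-nonNeg {F} {y} {c} 0≤F 0≤y 2y≤1 -2y≤c = subst (0ℚ ≤_) expand
    (nonNeg-* 0≤F (+-mono-≤ (+-mono-≤ (p≤q⇒0≤q-p _ _ -2y≤c) (p≤q⇒0≤q-p _ _ 2y≤1)) 0≤y))
    where
    expand : F * (((c - - (two * y)) + (1ℚ - (y + y))) + y) ≡ F * ((1ℚ + y) + c)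
    expand = solve 3 (λ F y c → F :* (((c :- :- (con two :* y)) :+ (con 1ℚ :- (y :+ y))) :+ y)
                                := F :* ((con 1ℚ :+ y) :+ c)) refl F y c

  -- (1 + 4x) F (1 + y + c) − F (1 + y) is a polynomial in the non-negative F, x, c + 2x, y − x
  -- and 1 − 2y with non-negative coefficients.
  correction-absorbed : ∀ {F x y c} → 0ℚ ≤ F → 0ℚ ≤ x → x ≤ y → y + y ≤ 1ℚ → - (two * x) ≤ c →
                        F * (1ℚ + y) ≤ (1ℚ + four * x) * (F * ((1ℚ + y) + c))
  correction-absorbed {F} {x} {y} {c} 0≤F 0≤x x≤y 2y≤1 -2x≤c = 0≤q-p⇒p≤q _ _ (subst (0ℚ ≤_) expand
    (nonNeg-* 0≤F (+-mono-≤ 0≤c+2x (nonNeg-* (nonNeg-* 0≤two 0≤x)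
      (+-mono-≤ (+-mono-≤ (nonNeg-* 0≤two 0≤c+2x) (nonNeg-* 0≤four (p≤q⇒0≤q-p _ _ x≤y))) (p≤q⇒0≤q-p _ _ 2y≤1))))))
    where
    0≤c+2x = p≤q⇒0≤q-p _ _ -2x≤c
    expand : F * ((c - - (two * x)) + (two * x) * ((two * (c - - (two * x)) + four * (y - x)) + (1ℚ - (y + y))))
             ≡ (1ℚ + four * x) * (F * ((1ℚ + y) + c)) - F * (1ℚ + y)
    expand = solve 4 (λ F x y c →
      F :* ((c :- :- (con two :* x)) :+ (con two :* x) :* ((con two :* (c :- :- (con two :* x)) :+ con four :* (y :- x))
                                                           :+ (con 1ℚ :- (y :+ y))))
      := (con 1ℚ :+ con four :* x) :* (F :* ((con 1ℚ :+ y) :+ c)) :- F :* (con 1ℚ :+ y)) refl F x y c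

module LocalFactor where

  open import Defs
  open Division using (divides?-+-∣; divides?≡true⇒∣; divides?≡false⇒∤)
  open LocalData using (CongruentAtLevel; deltaSymbol; deltaSymbol-congruent; deltaSymbol-saturated; delta-lower)
  open RationalBounds
  open import Data.Nat as ℕ using (ℕ; suc; NonZero; _^_)
  import Data.Nat.Properties as ℕ
  open import Data.Integer as ℤ using (+_)
  open import Data.Integer.Divisibility.Signed using (_∣_; ∣-refl; ∣n⇒∣m*n; ∣m+n∣n⇒∣m)
  open import Data.Rational as ℚ using (ℚ; 0ℚ; 1ℚ; _+_; _*_; -_; _≤_; nonNegative)
  open import Data.Rational.Properties using (≤-refl; ≤-trans; +-mono-≤; neg-antimono-≤; *-monoˡ-≤-nonNeg)
  open import Data.Bool using (true; false)
  open import Data.Product using (_×_; _,_; proj₂; uncurry)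
  open import Data.Sum using (_⊎_; inj₁; inj₂; [_,_]′)
  open import Relation.Binary.PropositionalEquality
  open import Relation.Nullary using (¬_)

  correction : ℕ → ℕ → Sign → ℚ
  correction l d plus  = 0ℚ
  correction l d zer   = - ((+ (l ℕ.+ 1) ℚ./ 1) * invℕ (l ^ (d ℕ.+ 2)))
  correction l d minus = - (two * invℕ (l ^ (d ℕ.+ 1)))

  cterm≡correction : ∀ l Δ → cterm l Δ ≡ uncurry (correction l) (deltaSymbol ℤ.∣ Δ ∣ l Δ)
  cterm≡correction l Δ with kronecker (divZ Δ (l ^ (2 ℕ.* delta l Δ))) l
  ... | plus  = refl
  ... | zer   = refl
  ... | minus = refl

  correction-nonPos : ∀ l d s → correction l d s ≤ 0ℚ
  correction-nonPos l d plus  = ≤-refl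
  correction-nonPos l d zer   = neg-antimono-≤ (nonNeg-* (0≤fromℕ/ (l ℕ.+ 1) 0) (invℕ-nonNeg (l ^ (d ℕ.+ 2))))
  correction-nonPos l d minus = neg-antimono-≤ (nonNeg-* 0≤two (invℕ-nonNeg (l ^ (d ℕ.+ 1))))

  correction-lower : ∀ {l} d s → 1 ℕ.< l → - (two * invℕ (l ^ (d ℕ.+ 1))) ≤ correction l d s
  correction-lower {l} d plus  _   = neg-antimono-≤ (nonNeg-* 0≤two (invℕ-nonNeg (l ^ (d ℕ.+ 1))))
  correction-lower {l} d zer   1<l = neg-antimono-≤
    (subst (λ n → (+ (l ℕ.+ 1) ℚ./ 1) * invℕ n ≤ two * invℕ (l ^ (d ℕ.+ 1))) l^[d+2]
      ([1+l]invℕ[M*l]≤two*invℕM (ℕ.<⇒≤ 1<l) (ℕ.m^n>0 l (d ℕ.+ 1))))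
    where
    instance _ = ℕ.>-nonZero (ℕ.<-trans ℕ.z<s 1<l)
    l^[d+2] : l ^ (d ℕ.+ 1) ℕ.* l ≡ l ^ (d ℕ.+ 2)
    l^[d+2] = trans (ℕ.*-comm _ l) (cong (l ^_) (sym (ℕ.+-suc d 1)))
  correction-lower d minus _   = ≤-refl

  cterm-nonPos : ∀ l Δ → cterm l Δ ≤ 0ℚ
  cterm-nonPos l Δ =
    subst (_≤ 0ℚ) (sym (cterm≡correction l Δ)) (uncurry (correction-nonPos l) (deltaSymbol ℤ.∣ Δ ∣ l Δ))

  cterm-lower : ∀ {l m} Δ → 1 ℕ.< l → m ℕ.≤ delta l Δ ℕ.+ 1 → - (two * invℕ (l ^ m)) ≤ cterm l Δ
  cterm-lower {l} {m} Δ 1<l m≤δ+1 = subst (_ ≤_) (sym (cterm≡correction l Δ)) (≤-trans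
    (neg-antimono-≤ (*-monoˡ-≤-nonNeg two {{nonNegative 0≤two}}
                      (invℕ-antimono (ℕ.m^n>0 l m) (ℕ.^-monoʳ-≤ l m≤δ+1))))
    (correction-lower (delta l Δ) (proj₂ (deltaSymbol ℤ.∣ Δ ∣ l Δ)) 1<l))
    where instance _ = ℕ.>-nonZero (ℕ.<-trans ℕ.z<s 1<l)

  v-cong : ∀ {l Δ Δ′} → deltaSymbol ℤ.∣ Δ ∣ l Δ ≡ deltaSymbol ℤ.∣ Δ′ ∣ l Δ′ → v l Δ ≡ v l Δ′
  v-cong {l} {Δ} {Δ′} same = cong (λ c → factor l * ((1ℚ + invℕ l) + c)) (begin
    cterm l Δ                                            ≡⟨ cterm≡correction l Δ ⟩
    uncurry (correction l) (deltaSymbol ℤ.∣ Δ ∣ l Δ)     ≡⟨ cong (uncurry (correction l)) same ⟩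
    uncurry (correction l) (deltaSymbol ℤ.∣ Δ′ ∣ l Δ′)   ≡⟨ cterm≡correction l Δ′ ⟨
    cterm l Δ′                                           ∎)
    where open ≡-Reasoning

  vk-congruent : ∀ {l j Δ Δ′} .{{_ : NonZero l}} → 1 ℕ.< l → Δ ≢ + 0 → Δ′ ≢ + 0 →
                 CongruentAtLevel l (suc j) Δ Δ′ → vk l (suc j) Δ ≡ vk l (suc j) Δ′
  vk-congruent {l} {j} {Δ} 1<l Δ≢0 Δ′≢0 c@(g , refl , _)
    rewrite divides?-+-∣ Δ (∣n⇒∣m*n g (∣-refl {+ (l ^ (2 ℕ.* suc j))}))
    with divides? (l ^ (2 ℕ.* suc j)) Δ in L∣?Δ
  ... | true  = refl
  ... | false = v-cong {l} {Δ} {Δ′} (begin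
    deltaSymbol ℤ.∣ Δ ∣ l Δ      ≡⟨ deltaSymbol-saturated {f = suc j} 1<l Δ≢0 Δ∤ ⟩
    deltaSymbol (suc j) l Δ      ≡⟨ deltaSymbol-congruent (suc j) (j , c , Δ∤) ⟩
    deltaSymbol (suc j) l Δ′     ≡⟨ deltaSymbol-saturated {f = suc j} 1<l Δ′≢0 Δ′∤ ⟨
    deltaSymbol ℤ.∣ Δ′ ∣ l Δ′    ∎)
    where
    open ≡-Reasoning
    Δ′ = Δ ℤ.+ g ℤ.* + (l ^ (2 ℕ.* suc j))
    Δ∤ : ¬ (+ (l ^ (2 ℕ.* suc j)) ∣ Δ)
    Δ∤ = divides?≡false⇒∤ L∣?Δ
    Δ′∤ : ¬ (+ (l ^ (2 ℕ.* suc j)) ∣ Δ′)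
    Δ′∤ L∣Δ′ = Δ∤ (∣m+n∣n⇒∣m L∣Δ′ (∣n⇒∣m*n g ∣-refl))

  vk-cases : ∀ l k Δ → (+ (l ^ (2 ℕ.* k)) ∣ Δ × vk l k Δ ≡ factor l * (1ℚ + invℕ l)) ⊎ vk l k Δ ≡ v l Δ
  vk-cases l k Δ with divides? (l ^ (2 ℕ.* k)) Δ in L∣?Δ
  ... | true  = inj₁ (divides?≡true⇒∣ L∣?Δ , refl)
  ... | false = inj₂ refl

  WithinFactor : ℚ → ℚ → ℚ → Set
  WithinFactor ε a b = (a ≤ (1ℚ + ε) * b) × (b ≤ (1ℚ + ε) * a)

  vk-close-to-v : ∀ {l j Δ} .{{_ : NonZero l}} → 1 ℕ.< l → Δ ≢ + 0 →
                  WithinFactor (four * invℕ (l ^ suc j)) (vk l (suc j) Δ) (v l Δ)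
  vk-close-to-v {l} {j} {Δ} 1<l Δ≢0 = [ divisible , not-divisible ]′ (vk-cases l (suc j) Δ)
    where
    ε = four * invℕ (l ^ suc j)
    0≤F = factor-nonNeg l
    0≤y = invℕ-nonNeg l
    2y≤1 = invℕ-half 1<l
    0≤x = invℕ-nonNeg (l ^ suc j)
    0≤ε = nonNeg-* 0≤four 0≤x
    x≤y = invℕ-antimono (ℕ.<⇒≤ 1<l) (ℕ.m≤m*n l (l ^ j) {{ℕ.m^n≢0 l j}})

    divisible : + (l ^ (2 ℕ.* suc j)) ∣ Δ × vk l (suc j) Δ ≡ factor l * (1ℚ + invℕ l) →
                WithinFactor ε (vk l (suc j) Δ) (v l Δ)
    divisible (L∣Δ , vk≡) rewrite vk≡ =
      correction-absorbed 0≤F 0≤x x≤y 2y≤1 (cterm-lower Δ 1<l k≤δ+1) ,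
      ≤-trans (*-+-nonPos-≤ 0≤F (cterm-nonPos l Δ)) (≤-[1+ε]* 0≤ε (nonNeg-* 0≤F (+-mono-≤ 0≤1 0≤y)))
      where
      k≤δ+1 : suc j ℕ.≤ delta l Δ ℕ.+ 1
      k≤δ+1 = subst (suc j ℕ.≤_) (ℕ.+-comm 1 (delta l Δ)) (ℕ.s≤s (delta-lower 1<l Δ≢0 L∣Δ))

    not-divisible : vk l (suc j) Δ ≡ v l Δ → WithinFactor ε (vk l (suc j) Δ) (v l Δ)
    not-divisible vk≡v rewrite vk≡v = ≤-[1+ε]* 0≤ε 0≤v , ≤-[1+ε]* 0≤ε 0≤v
      where
      -2y≤c : - (two * invℕ l) ≤ cterm l Δ
      -2y≤c = subst (λ n → - (two * invℕ n) ≤ cterm l Δ) (ℕ.*-identityʳ l) (cterm-lower Δ 1<l (ℕ.m≤n+m 1 _))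
      0≤v : 0ℚ ≤ v l Δ
      0≤v = 1+y+c-nonNeg 0≤F 0≤y 2y≤1 -2y≤c

open import Defs
open import Data.Nat using (ℕ; suc; _≤_; _^_; _*_)
open import Data.Nat.Primality using (Prime; prime⇒nonZero)
open import Data.Integer using (ℤ; +_; _+_)
open import Data.Rational using (ℚ; 1ℚ) renaming (_+_ to _+ℚ_; _*_ to _*ℚ_; _≤_ to _≤ℚ_)
open import Data.Product using (_×_; _,_; ∃)
open import Relation.Binary.PropositionalEquality using (_≡_; sym)
open Discriminant using (prime⇒1<; disc≢0; disc-congruent)
open RationalBounds using (four)
open LocalFactor using (WithinFactor; vk-congruent; vk-close-to-v)

lemma4p9 :
  ((p l k : ℕ) → Prime p → Prime l → 1 ≤ k → (t : ℤ) →
     vk l k (disc (t + + (l ^ (2 * k))) p) ≡ vk l k (disc t p))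
  ×
  ∃ λ (K : ℚ) → (p l k : ℕ) → Prime p → Prime l → 1 ≤ k → (t : ℤ) →
     (vk l k (disc t p) ≤ℚ (1ℚ +ℚ (K *ℚ invℕ (l ^ k))) *ℚ v l (disc t p))
     × (v l (disc t p) ≤ℚ (1ℚ +ℚ (K *ℚ invℕ (l ^ k))) *ℚ vk l k (disc t p))
lemma4p9 = periodic , four , close
  where
  periodic : (p l k : ℕ) → Prime p → Prime l → 1 ≤ k → (t : ℤ) →
             vk l k (disc (t + + (l ^ (2 * k))) p) ≡ vk l k (disc t p)
  periodic p l (suc j) p-prime l-prime _ t =
    sym (vk-congruent {j = j} {{prime⇒nonZero l-prime}} (prime⇒1< l-prime)
           (disc≢0 t p-prime) (disc≢0 (t + + (l ^ (2 * suc j))) p-prime) (disc-congruent j t p))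
  close : (p l k : ℕ) → Prime p → Prime l → 1 ≤ k → (t : ℤ) →
          WithinFactor (four *ℚ invℕ (l ^ k)) (vk l k (disc t p)) (v l (disc t p))
  close p l (suc j) p-prime l-prime _ t =
    vk-close-to-v {j = j} {{prime⇒nonZero l-prime}} (prime⇒1< l-prime) (disc≢0 t p-prime)
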